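{- Let $a,b$ be positive square-free integers with $\gcd(a,b) \leq 2$, and let $f(x_0,y_1,y_2,y_3) = x_0^2 - a y_1^2 - b y_2^2 - ab y_3^2$. Let $d \in \mathbb{Z}$ be square-free. Then for every odd prime $p$ dividing $ab$, $f$ properly represents $d \bmod p^2$, i.e., there exist integers $r_0,r_1,r_2,r_3$ with $\gcd(r_0,r_1,r_2,r_3) = 1$ and $f(r_0,r_1,r_2,r_3) \equiv d \pmod{p^2}$. -}

module Defs where

open import Data.Nat as ℕ using (ℕ)
open import Data.Nat.GCD using (gcd)
open import Data.Nat.Divisibility as ℕᵈ using ()
open import Data.Integer as ℤ using (ℤ; ∣_∣; _-_; _*_)
open import Data.Integer.Divisibility as ℤᵈ using ()
open import Relation.Binary.PropositionalEquality using (_≡_)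

-- An integer n is square-free iff the only natural number m with m² ∣ n is m = 1.
-- (In particular 0 is not square-free.)
SquareFree : ℤ → Set
SquareFree n = ∀ (m : ℕ) → (m ℕ.* m) ℕᵈ.∣ ∣ n ∣ → m ≡ 1

gcd₄ : ℤ → ℤ → ℤ → ℤ → ℕ
gcd₄ r₀ r₁ r₂ r₃ = gcd (gcd (gcd ∣ r₀ ∣ ∣ r₁ ∣) ∣ r₂ ∣) ∣ r₃ ∣

f : ℤ → ℤ → ℤ → ℤ → ℤ → ℤ → ℤ
f a b x₀ y₁ y₂ y₃ = x₀ * x₀ - a * (y₁ * y₁) - b * (y₂ * y₂) - (a * b) * (y₃ * y₃)

infix 4 _≡_[mod_]
_≡_[mod_] : ℤ → ℤ → ℤ → Set
x ≡ y [mod m ] = m ℤᵈ.∣ (x - y)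

{-# OPTIONS --safe #-}

-- Say p ∣ a; then p ∤ b since gcd a b ≤ 2, and a = q p with p ∤ q since a is square-free (the
-- case p ∣ b is symmetric).  For a diagonal binary form u x² + v y² + e with p ∤ u v, the
-- (p+1)/2 values u x² and the (p+1)/2 values −v y² − e, each pairwise incongruent mod p, must
-- meet, so the form has a root mod p; if p ∤ e one coordinate of the root is prime to p, and
-- Hensel's lemma lifts it to a root mod p².
-- If p ∤ d, lift a root of x₀² − b y₂² − d and take y₁ = p, y₃ = 0: the term a p² vanishes mod p².
-- If p ∣ d then d = d' p with p ∤ d', and with x₀ = 0, y₂ = p the congruence becomes
-- q (y₁² + b y₃²) + d' ≡ 0 (mod p), solvable by the same pigeonhole argument.
-- Either way the vector has a coordinate p and a coordinate prime to p, hence is primitive.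

module Submission where

open import Defs
open import Data.Nat as ℕ using (ℕ)
open import Data.Nat.GCD using (gcd)
open import Data.Nat.Divisibility as ℕᵈ using ()
open import Data.Nat.Primality using (Prime)
open import Data.Integer as ℤ using (ℤ; +_; ∣_∣)
open import Data.Product using (Σ; _×_; ∃-syntax)
open import Relation.Binary.PropositionalEquality using (_≡_; _≢_)

open import Data.Nat.GCD using (gcd-greatest; gcd[m,n]≡0⇒m≡0; gcd[m,n]∣m; gcd[m,n]∣n)
open import Data.Nat.Primality
  using (euclidsLemma; prime⇒irreducible; prime⇒nonZero; prime⇒nonTrivial)
open import Data.Nat.DivMod using (_%_; _/_; m%n<n; m≡m%n+[m/n]*n)
import Data.Nat.Properties as ℕ
open import Data.Integer using (0ℤ; _+_; _*_; _-_; -_)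
open import Data.Integer.Properties
  using (abs-*; pos-*; pos-+; neg-involutive; +-assoc; +-identityʳ; +-injective;
         i-j≡0⇒i≡j; ∣i∣≡0⇒i≡0; [+m]-[+n]≡m⊖n; ∣m⊝n∣≤m⊔n)
open import Data.Integer.DivMod using (_%ℕ_; _/ℕ_; n%ℕd<d; a≡a%ℕn+[a/ℕn]*n)
open import Data.Integer.Divisibility.Signed
  using (_∣_; divides; _∣?_; ∣ᵤ⇒∣; ∣⇒∣ᵤ; ∣-refl; ∣m∣n⇒∣m+n; ∣m+n∣m⇒∣n; ∣m+n∣n⇒∣m; ∣m⇒∣-m;
         ∣n⇒∣m*n; ∣m⇒∣m*n; *-monoˡ-∣)
open import Data.Integer.Tactic.RingSolver using (solve-∀)
open import Data.Fin using (Fin; zero; toℕ; fromℕ<; splitAt; _↑ˡ_; _↑ʳ_)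
open import Data.Fin.Properties
  using (pigeonhole; toℕ-fromℕ<; toℕ-injective; toℕ<n; <⇒≢; splitAt⁻¹-↑ˡ; splitAt⁻¹-↑ʳ)
open import Data.Sum using (_⊎_; inj₁; inj₂; [_,_]′)
open import Data.Product using (_,_; proj₁; proj₂)
open import Function using (_∘_; _$_; id)
open import Relation.Nullary using (¬_; yes; no; contradiction)
open import Relation.Binary.PropositionalEquality
  using (refl; sym; trans; cong; cong₂; subst; subst₂; module ≡-Reasoning)

-- Phrased through common divisors rather than gcd₄, so that it is invariant under permuting
-- the coordinates.
Primitive : ℤ → ℤ → ℤ → ℤ → Set
Primitive r₀ r₁ r₂ r₃ =
  ∀ g → g ℕᵈ.∣ ∣ r₀ ∣ → g ℕᵈ.∣ ∣ r₁ ∣ → g ℕᵈ.∣ ∣ r₂ ∣ → g ℕᵈ.∣ ∣ r₃ ∣ → g ≡ 1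

primitive⇒gcd₄≡1 : ∀ r₀ r₁ r₂ r₃ → Primitive r₀ r₁ r₂ r₃ → gcd₄ r₀ r₁ r₂ r₃ ≡ 1
primitive⇒gcd₄≡1 r₀ r₁ r₂ r₃ prim =
  prim _ (∣-trans g∣g₀₁ (gcd[m,n]∣m ∣ r₀ ∣ ∣ r₁ ∣))
         (∣-trans g∣g₀₁ (gcd[m,n]∣n ∣ r₀ ∣ ∣ r₁ ∣))
         (∣-trans g∣g₀₁₂ (gcd[m,n]∣n (gcd ∣ r₀ ∣ ∣ r₁ ∣) ∣ r₂ ∣))
         (gcd[m,n]∣n g₀₁₂ ∣ r₃ ∣)
  where
  open ℕᵈ using (∣-trans)
  g₀₁₂ : ℕ
  g₀₁₂ = gcd (gcd ∣ r₀ ∣ ∣ r₁ ∣) ∣ r₂ ∣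
  g∣g₀₁₂ : gcd₄ r₀ r₁ r₂ r₃ ℕᵈ.∣ g₀₁₂
  g∣g₀₁₂ = gcd[m,n]∣m g₀₁₂ ∣ r₃ ∣
  g∣g₀₁ : gcd₄ r₀ r₁ r₂ r₃ ℕᵈ.∣ gcd ∣ r₀ ∣ ∣ r₁ ∣
  g∣g₀₁ = ∣-trans g∣g₀₁₂ (gcd[m,n]∣m (gcd ∣ r₀ ∣ ∣ r₁ ∣) ∣ r₂ ∣)

record PrimitivelyRepresents (a b d m : ℤ) : Set where
  constructor representation
  field
    r₀ r₁ r₂ r₃ : ℤ
    is-primitive : Primitive r₀ r₁ r₂ r₃
    m∣f-d : m ∣ f a b r₀ r₁ r₂ r₃ - d

primitivelyRepresents⇒gcd₄≡1 : ∀ {a b d m} → PrimitivelyRepresents a b d m →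
  ∃[ r₀ ] ∃[ r₁ ] ∃[ r₂ ] ∃[ r₃ ] ((gcd₄ r₀ r₁ r₂ r₃ ≡ 1) × (f a b r₀ r₁ r₂ r₃ ≡ d [mod m ]))
primitivelyRepresents⇒gcd₄≡1 (representation r₀ r₁ r₂ r₃ prim m∣) =
  r₀ , r₁ , r₂ , r₃ , primitive⇒gcd₄≡1 r₀ r₁ r₂ r₃ prim , ∣⇒∣ᵤ m∣

f-swap : ∀ a b x y z w → f a b x y z w ≡ f b a x z y w
f-swap a b x y z w = expanded a b x y z w
  where
  expanded : ∀ a b x y z w →
    x * x - a * (y * y) - b * (z * z) - (a * b) * (w * w) ≡
    x * x - b * (z * z) - a * (y * y) - (b * a) * (w * w)
  expanded = solve-∀

binary-form-swap : ∀ u v e x y → u * (x * x) + v * (y * y) + e ≡ v * (y * y) + u * (x * x) + e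
binary-form-swap = solve-∀

primitivelyRepresents-swap : ∀ {a b d m} →
  PrimitivelyRepresents a b d m → PrimitivelyRepresents b a d m
primitivelyRepresents-swap {a} {b} {d} {m} (representation r₀ r₁ r₂ r₃ prim m∣) =
  representation r₀ r₂ r₁ r₃ (λ g g₀ g₂ g₁ g₃ → prim g g₀ g₁ g₂ g₃)
    (subst (λ v → m ∣ v - d) (f-swap a b r₀ r₁ r₂ r₃) m∣)

∣∧<⇒≡0 : ∀ {m n} → m ℕᵈ.∣ n → n ℕ.< m → n ≡ 0
∣∧<⇒≡0 {n = 0} _ _ = refl
∣∧<⇒≡0 {n = ℕ.suc _} m∣n n<m = contradiction m∣n (ℕᵈ.>⇒∤ n<m)

prime≢2⇒odd : ∀ {p} → Prime p → p ≢ 2 → ∃[ h ] p ≡ ℕ.suc (h ℕ.+ h)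
prime≢2⇒odd {p} p-prime p≢2 = split (p % 2) (m%n<n p 2) (m≡m%n+[m/n]*n p 2)
  where
  h*2≡h+h : (p / 2) ℕ.* 2 ≡ p / 2 ℕ.+ p / 2
  h*2≡h+h = trans (ℕ.*-comm (p / 2) 2) (cong (p / 2 ℕ.+_) (ℕ.+-identityʳ (p / 2)))
  split : ∀ r → r ℕ.< 2 → p ≡ r ℕ.+ (p / 2) ℕ.* 2 → ∃[ h ] p ≡ ℕ.suc (h ℕ.+ h)
  split 0 _ p≡2h with prime⇒irreducible p-prime (ℕᵈ.divides (p / 2) p≡2h)
  ... | inj₂ 2≡p = contradiction (sym 2≡p) p≢2
  split 1 _ p≡1+2h = p / 2 , trans p≡1+2h (cong ℕ.suc h*2≡h+h)
  split (ℕ.suc (ℕ.suc _)) (ℕ.s≤s (ℕ.s≤s ())) _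

prime≢2∤≤2 : ∀ {p n} → Prime p → p ≢ 2 → .{{ℕ.NonZero n}} → n ℕ.≤ 2 → ¬ p ℕᵈ.∣ n
prime≢2∤≤2 {p} p-prime p≢2 n≤2 p∣n =
  p≢2 (ℕ.≤-antisym (ℕ.≤-trans (ℕᵈ.∣⇒≤ p∣n) n≤2)
                   (ℕ.nonTrivial⇒n>1 p {{prime⇒nonTrivial p-prime}}))

prime≢2∤-when-gcd≤2 : ∀ {p a b} → Prime p → p ≢ 2 → 0 ℕ.< a → gcd a b ℕ.≤ 2 →
  p ℕᵈ.∣ a → ¬ p ℕᵈ.∣ b
prime≢2∤-when-gcd≤2 {a = a} {b} p-prime p≢2 0<a gcd≤2 p∣a p∣b =
  prime≢2∤≤2 p-prime p≢2 {{gcd≢0}} gcd≤2 (gcd-greatest p∣a p∣b)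
  where
  gcd≢0 : ℕ.NonZero (gcd a b)
  gcd≢0 = ℕ.≢-nonZero (λ gcd≡0 → ℕ.<⇒≢ 0<a (sym (gcd[m,n]≡0⇒m≡0 gcd≡0)))

module OddPrime {p : ℕ} (p-prime : Prime p) (p≢2 : p ≢ 2) where

  instance
    p-nonZero : ℕ.NonZero p
    p-nonZero = prime⇒nonZero p-prime

  P : ℤ
  P = + p

  P∤+ : ∀ {n} → ¬ p ℕᵈ.∣ n → ¬ P ∣ + n
  P∤+ p∤n = p∤n ∘ ∣⇒∣ᵤ

  P∤1 : ¬ P ∣ + 1
  P∤1 = P∤+ (prime≢2∤≤2 p-prime p≢2 (ℕ.s≤s ℕ.z≤n))

  P∤2 : ¬ P ∣ + 2
  P∤2 = P∤+ (prime≢2∤≤2 p-prime p≢2 ℕ.≤-refl)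

  P∣-euclid : ∀ x y → P ∣ x * y → (P ∣ x) ⊎ (P ∣ y)
  P∣-euclid x y P∣xy
    with euclidsLemma ∣ x ∣ ∣ y ∣ p-prime (subst (p ℕᵈ.∣_) (abs-* x y) (∣⇒∣ᵤ P∣xy))
  ... | inj₁ p∣x = inj₁ (∣ᵤ⇒∣ p∣x)
  ... | inj₂ p∣y = inj₂ (∣ᵤ⇒∣ p∣y)

  P∤* : ∀ {x y} → ¬ P ∣ x → ¬ P ∣ y → ¬ P ∣ x * y
  P∤* P∤x P∤y P∣xy = [ P∤x , P∤y ]′ (P∣-euclid _ _ P∣xy)

  P∣-cancelˡ : ∀ {k x} → ¬ P ∣ k → P ∣ k * x → P ∣ x
  P∣-cancelˡ {k} {x} P∤k P∣kx = [ (λ P∣k → contradiction P∣k P∤k) , id ]′ (P∣-euclid k x P∣kx)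

  P∣-⇒P∣ : ∀ {x} → P ∣ - x → P ∣ x
  P∣-⇒P∣ {x} P∣-x = subst (P ∣_) (neg-involutive x) (∣m⇒∣-m P∣-x)

  P∤- : ∀ {x} → ¬ P ∣ x → ¬ P ∣ - x
  P∤- P∤x = P∤x ∘ P∣-⇒P∣

  P∤+*P : ∀ {x} → ¬ P ∣ x → ∀ s → ¬ P ∣ x + s * P
  P∤+*P P∤x s P∣ = P∤x (∣m+n∣n⇒∣m P∣ (divides s refl))

  P∣+m-+n⇒≡ : ∀ {m n} → m ℕ.< p → n ℕ.< p → P ∣ + m - + n → m ≡ n
  P∣+m-+n⇒≡ {m} {n} m<p n<p P∣m-n =
    +-injective (i-j≡0⇒i≡j (+ m) (+ n) (∣i∣≡0⇒i≡0 (∣∧<⇒≡0 (∣⇒∣ᵤ P∣m-n) ∣m-n∣<p)))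
    where
    ∣m-n∣<p : ∣ + m - + n ∣ ℕ.< p
    ∣m-n∣<p = subst (ℕ._< p) (cong ∣_∣ (sym ([+m]-[+n]≡m⊖n m n)))
                (ℕ.≤-<-trans (∣m⊝n∣≤m⊔n m n) (ℕ.⊔-lub m<p n<p))

  residue : ℤ → Fin p
  residue x = fromℕ< (n%ℕd<d x p)

  residue-≡⇒P∣- : ∀ x y → residue x ≡ residue y → P ∣ x - y
  residue-≡⇒P∣- x y same = divides (x /ℕ p - y /ℕ p) (begin
    x - y
      ≡⟨ cong₂ _-_ (a≡a%ℕn+[a/ℕn]*n x p) (a≡a%ℕn+[a/ℕn]*n y p) ⟩
    (+ (x %ℕ p) + x /ℕ p * P) - (+ (y %ℕ p) + y /ℕ p * P)
      ≡⟨ cong (λ r → (+ r + x /ℕ p * P) - (+ (y %ℕ p) + y /ℕ p * P)) x%p≡y%p ⟩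
    (+ (y %ℕ p) + x /ℕ p * P) - (+ (y %ℕ p) + y /ℕ p * P)
      ≡⟨ cancel (+ (y %ℕ p)) (x /ℕ p) (y /ℕ p) P ⟩
    (x /ℕ p - y /ℕ p) * P ∎)
    where
    open ≡-Reasoning
    x%p≡y%p : x %ℕ p ≡ y %ℕ p
    x%p≡y%p = trans (sym (toℕ-fromℕ< (n%ℕd<d x p)))
                (trans (cong toℕ same) (toℕ-fromℕ< (n%ℕd<d y p)))
    cancel : ∀ r a b m → (r + a * m) - (r + b * m) ≡ (a - b) * m
    cancel = solve-∀

  Incongruent : ∀ {n} → (Fin n → ℤ) → Set
  Incongruent F = ∀ i j → P ∣ F i - F j → i ≡ j

  incongruent-meet : ∀ {n n'} (F : Fin n → ℤ) (G : Fin n' → ℤ) → p ℕ.< n ℕ.+ n' →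
                     Incongruent F → Incongruent G → ∃[ i ] ∃[ j ] P ∣ F i - G j
  incongruent-meet {n} {n'} F G p<n+n' F-inc G-inc
    with i , j , i<j , same ← pigeonhole p<n+n' (residue ∘ [ F , G ]′ ∘ splitAt n)
    = meet (<⇒≢ i<j)
           (residue-≡⇒P∣- ([ F , G ]′ (splitAt n i)) ([ F , G ]′ (splitAt n j)) same)
    where
    flip : ∀ x y → P ∣ x - y → P ∣ y - x
    flip x y P∣x-y = subst (P ∣_) (negate x y) (∣m⇒∣-m P∣x-y)
      where
      negate : ∀ x y → - (x - y) ≡ y - x
      negate = solve-∀
    meet : ∀ {i j} → i ≢ j → P ∣ [ F , G ]′ (splitAt n i) - [ F , G ]′ (splitAt n j) →
           ∃[ i ] ∃[ j ] P ∣ F i - G j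
    meet {i} {j} i≢j P∣ with splitAt n i in split-i | splitAt n j in split-j
    ... | inj₁ k | inj₂ l = k , l , P∣
    ... | inj₂ l | inj₁ k = k , l , flip (G l) (F k) P∣
    ... | inj₁ k | inj₁ k' = contradiction
          (trans (sym (splitAt⁻¹-↑ˡ split-i))
                 (trans (cong (_↑ˡ n') (F-inc k k' P∣)) (splitAt⁻¹-↑ˡ split-j)))
          i≢j
    ... | inj₂ l | inj₂ l' = contradiction
          (trans (sym (splitAt⁻¹-↑ʳ split-i))
                 (trans (cong (n ↑ʳ_) (G-inc l l' P∣)) (splitAt⁻¹-↑ʳ split-j)))
          i≢j

  incongruent-affine : ∀ {n k} {F : Fin n → ℤ} → ¬ P ∣ k → ∀ t →
                       Incongruent F → Incongruent (λ i → k * F i + t)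
  incongruent-affine {k = k} {F} P∤k t F-inc i j P∣ =
    F-inc i j (P∣-cancelˡ {k} {F i - F j} P∤k (subst (P ∣_) (shift-cancels k (F i) (F j) t) P∣))
    where
    shift-cancels : ∀ k a b t → (k * a + t) - (k * b + t) ≡ k * (a - b)
    shift-cancels = solve-∀

  incongruent-naturals : Incongruent {p} (λ i → + toℕ i)
  incongruent-naturals i j P∣ = toℕ-injective (P∣+m-+n⇒≡ (toℕ<n i) (toℕ<n j) P∣)

  private
    half : ℕ
    half = proj₁ (prime≢2⇒odd p-prime p≢2)

    p≡1+2half : p ≡ ℕ.suc (half ℕ.+ half)
    p≡1+2half = proj₂ (prime≢2⇒odd p-prime p≢2)

    p<2[1+half] : p ℕ.< ℕ.suc half ℕ.+ ℕ.suc half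
    p<2[1+half] = subst (ℕ._< ℕ.suc half ℕ.+ ℕ.suc half) (sym p≡1+2half)
                    (ℕ.s≤s (ℕ.+-monoʳ-< half (ℕ.n<1+n half)))

  P∣x²-y²⇒≡ : ∀ {x y} → x ℕ.≤ half → y ℕ.≤ half → P ∣ + x * + x - + y * + y → x ≡ y
  P∣x²-y²⇒≡ {x} {y} x≤half y≤half P∣
    with P∣-euclid (+ x - + y) (+ x + + y) (subst (P ∣_) (difference-of-squares (+ x) (+ y)) P∣)
    where
    difference-of-squares : ∀ x y → x * x - y * y ≡ (x - y) * (x + y)
    difference-of-squares = solve-∀
  ... | inj₁ P∣x-y = P∣+m-+n⇒≡ (≤half⇒<p x≤half) (≤half⇒<p y≤half) P∣x-y
    where
    ≤half⇒<p : ∀ {z} → z ℕ.≤ half → z ℕ.< p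
    ≤half⇒<p {z} z≤half =
      subst (z ℕ.<_) (sym p≡1+2half) (ℕ.s≤s (ℕ.≤-trans z≤half (ℕ.m≤m+n half half)))
  ... | inj₂ P∣x+y = trans (ℕ.m+n≡0⇒m≡0 x x+y≡0) (sym (ℕ.m+n≡0⇒n≡0 x x+y≡0))
    where
    x+y<p : x ℕ.+ y ℕ.< p
    x+y<p = subst (x ℕ.+ y ℕ.<_) (sym p≡1+2half) (ℕ.s≤s (ℕ.+-mono-≤ x≤half y≤half))
    x+y≡0 : x ℕ.+ y ≡ 0
    x+y≡0 = ∣∧<⇒≡0 (∣⇒∣ᵤ (subst (P ∣_) (sym (pos-+ x y)) P∣x+y)) x+y<p

  square : ∀ {n} → Fin n → ℤ
  square i = + toℕ i * + toℕ i

  incongruent-squares : Incongruent {ℕ.suc half} square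
  incongruent-squares i j P∣ =
    toℕ-injective (P∣x²-y²⇒≡ (ℕ.≤-pred (toℕ<n i)) (ℕ.≤-pred (toℕ<n j)) P∣)

  linear-congruence-solvable : ∀ {k} → ¬ P ∣ k → ∀ t → ∃[ s ] P ∣ k * s + t
  linear-congruence-solvable {k} P∤k t =
    solution (incongruent-meet (λ i → k * + toℕ i + t) (λ _ → 0ℤ) (ℕ.m<m+n p {1} ℕ.z<s)
               (incongruent-affine {k = k} P∤k t incongruent-naturals) (λ { zero zero _ → refl }))
    where
    solution : (Σ (Fin p) λ i → Σ (Fin 1) λ _ → P ∣ (k * + toℕ i + t) - 0ℤ) →
               ∃[ s ] P ∣ k * s + t
    solution (i , _ , P∣) = + toℕ i , subst (P ∣_) (+-identityʳ _) P∣

  binary-form-solvable : ∀ {u v} → ¬ P ∣ u → ¬ P ∣ v → ∀ e →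
                         ∃[ x ] ∃[ y ] P ∣ u * (x * x) + v * (y * y) + e
  binary-form-solvable {u} {v} P∤u P∤v e =
    solution (incongruent-meet (λ i → u * square i + 0ℤ) (λ j → - v * square j + - e) p<2[1+half]
               (incongruent-affine {k = u} {F = square} P∤u 0ℤ incongruent-squares)
               (incongruent-affine {k = - v} {F = square} (P∤- P∤v) (- e) incongruent-squares))
    where
    rearrange : ∀ u v e X Y → (u * X + 0ℤ) - (- v * Y + - e) ≡ u * X + v * Y + e
    rearrange = solve-∀
    solution : (∃[ i ] ∃[ j ] P ∣ (u * square {ℕ.suc half} i + 0ℤ) - (- v * square j + - e)) →
               ∃[ x ] ∃[ y ] P ∣ u * (x * x) + v * (y * y) + e
    solution (i , j , P∣) =
      + toℕ i , + toℕ j , subst (P ∣_) (rearrange u v e (square i) (square j)) P∣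

  P∤e⇒coprime-solution : ∀ u v {e} x y → ¬ P ∣ e → P ∣ u * (x * x) + v * (y * y) + e →
                          (¬ P ∣ x) ⊎ (¬ P ∣ y)
  P∤e⇒coprime-solution u v x y P∤e P∣ with P ∣? x | P ∣? y
  ... | no P∤x | _ = inj₁ P∤x
  ... | yes _ | no P∤y = inj₂ P∤y
  ... | yes P∣x | yes P∣y =
    contradiction (∣m+n∣m⇒∣n P∣ (∣m∣n⇒∣m+n (P∣u*z² P∣x u) (P∣u*z² P∣y v))) P∤e
    where
    P∣u*z² : ∀ {z} → P ∣ z → ∀ u → P ∣ u * (z * z)
    P∣u*z² {z} P∣z u = ∣n⇒∣m*n u (∣m⇒∣m*n z P∣z)

  hensel-lift : ∀ k x r → ¬ P ∣ + 2 * k → ¬ P ∣ x → P ∣ k * (x * x) + r →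
                ∃[ x' ] (¬ P ∣ x') × P * P ∣ k * (x' * x') + r
  -- With k x² + r = t p, the lift is x + s p where 2 k x s + t ≡ 0 (mod p).
  hensel-lift k x r P∤2k P∤x (divides t kx²+r≡tP) =
    lift (linear-congruence-solvable (P∤* P∤2k P∤x) t)
    where
    open ≡-Reasoning
    expand : ∀ k x r s P → k * ((x + s * P) * (x + s * P)) + r ≡
                           (k * (x * x) + r) + (+ 2 * k * x * s) * P + k * (s * s) * (P * P)
    expand = solve-∀
    regroup : ∀ a t P c → t * P + a * P + c ≡ (a + t) * P + c
    regroup = solve-∀
    collect : ∀ j c P → j * P * P + c * (P * P) ≡ (j + c) * (P * P)
    collect = solve-∀
    lift : (∃[ s ] P ∣ + 2 * k * x * s + t) → ∃[ x' ] (¬ P ∣ x') × P * P ∣ k * (x' * x') + r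
    lift (s , divides j 2kxs+t≡jP) = x + s * P , P∤+*P P∤x s , divides (j + k * (s * s)) (begin
      k * ((x + s * P) * (x + s * P)) + r
        ≡⟨ expand k x r s P ⟩
      (k * (x * x) + r) + (+ 2 * k * x * s) * P + k * (s * s) * (P * P)
        ≡⟨ cong (λ z → z + (+ 2 * k * x * s) * P + k * (s * s) * (P * P)) kx²+r≡tP ⟩
      t * P + (+ 2 * k * x * s) * P + k * (s * s) * (P * P)
        ≡⟨ regroup (+ 2 * k * x * s) t P (k * (s * s) * (P * P)) ⟩
      (+ 2 * k * x * s + t) * P + k * (s * s) * (P * P)
        ≡⟨ cong (λ z → z * P + k * (s * s) * (P * P)) 2kxs+t≡jP ⟩
      j * P * P + k * (s * s) * (P * P)
        ≡⟨ collect j (k * (s * s)) P ⟩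
      (j + k * (s * s)) * (P * P) ∎)

  record BinaryFormRoot (u v e m : ℤ) : Set where
    constructor root
    field
      x y : ℤ
      coprime : (¬ P ∣ x) ⊎ (¬ P ∣ y)
      m∣ : m ∣ u * (x * x) + v * (y * y) + e

  binaryFormRoot-swap : ∀ {u v e m} → BinaryFormRoot u v e m → BinaryFormRoot v u e m
  binaryFormRoot-swap {u} {v} {e} {m} (root x y P∤x⊎P∤y m∣) =
    root y x ([ inj₂ , inj₁ ]′ P∤x⊎P∤y) (subst (m ∣_) (binary-form-swap u v e x y) m∣)

  lift-first-coordinate : ∀ u v e x y → ¬ P ∣ u → ¬ P ∣ x → P ∣ u * (x * x) + v * (y * y) + e →
                          BinaryFormRoot u v e (P * P)
  lift-first-coordinate u v e x y P∤u P∤x P∣ =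
    lifted (hensel-lift u x (v * (y * y) + e) (P∤* P∤2 P∤u) P∤x
              (subst (P ∣_) (+-assoc (u * (x * x)) (v * (y * y)) e) P∣))
    where
    lifted : (∃[ x' ] (¬ P ∣ x') × P * P ∣ u * (x' * x') + (v * (y * y) + e)) →
             BinaryFormRoot u v e (P * P)
    lifted (x' , P∤x' , P²∣) =
      root x' y (inj₁ P∤x') (subst (P * P ∣_) (sym (+-assoc (u * (x' * x')) (v * (y * y)) e)) P²∣)

  binaryFormRoot-exists : ∀ u v e → ¬ P ∣ u → ¬ P ∣ v → ¬ P ∣ e → BinaryFormRoot u v e P
  binaryFormRoot-exists u v e P∤u P∤v P∤e = coprime (binary-form-solvable P∤u P∤v e)
    where
    coprime : (∃[ x ] ∃[ y ] P ∣ u * (x * x) + v * (y * y) + e) → BinaryFormRoot u v e P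
    coprime (x , y , P∣) = root x y (P∤e⇒coprime-solution u v x y P∤e P∣) P∣

  binaryFormRoot-lift : ∀ u v e → ¬ P ∣ u → ¬ P ∣ v →
                        BinaryFormRoot u v e P → BinaryFormRoot u v e (P * P)
  binaryFormRoot-lift u v e P∤u _ (root x y (inj₁ P∤x) P∣) =
    lift-first-coordinate u v e x y P∤u P∤x P∣
  binaryFormRoot-lift u v e _ P∤v (root x y (inj₂ P∤y) P∣) =
    binaryFormRoot-swap {v} {u} {e}
      (lift-first-coordinate v u e y x P∤v P∤y (subst (P ∣_) (binary-form-swap u v e x y) P∣))

  common-divisor-with-p≡1 : ∀ {g x} → g ℕᵈ.∣ p → g ℕᵈ.∣ ∣ x ∣ → ¬ P ∣ x → g ≡ 1
  common-divisor-with-p≡1 g∣p g∣x P∤x with prime⇒irreducible p-prime g∣p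
  ... | inj₁ g≡1 = g≡1
  ... | inj₂ refl = contradiction (∣ᵤ⇒∣ g∣x) P∤x

  represents-unit : ∀ q {c d} → ¬ P ∣ c → ¬ P ∣ d → PrimitivelyRepresents (q * P) c d (P * P)
  represents-unit q {c} {d} P∤c P∤d =
    embed (binaryFormRoot-lift (+ 1) (- c) (- d) P∤1 (P∤- P∤c)
            (binaryFormRoot-exists (+ 1) (- c) (- d) P∤1 (P∤- P∤c) (P∤- P∤d)))
    where
    expand : ∀ q c d x y P →
      x * x - q * P * (P * P) - c * (y * y) - q * P * c * (0ℤ * 0ℤ) - d ≡
      + 1 * (x * x) + - c * (y * y) + - d + - (q * P) * (P * P)
    expand = solve-∀
    embed : BinaryFormRoot (+ 1) (- c) (- d) (P * P) → PrimitivelyRepresents (q * P) c d (P * P)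
    embed (root x y P∤x⊎P∤y P²∣) =
      representation x P y 0ℤ
        (λ g g∣x g∣p g∣y _ →
           [ common-divisor-with-p≡1 g∣p g∣x , common-divisor-with-p≡1 g∣p g∣y ]′ P∤x⊎P∤y) $
        subst (P * P ∣_) (sym (expand q c d x y P)) (∣m∣n⇒∣m+n P²∣ (∣n⇒∣m*n (- (q * P)) ∣-refl))

  represents-multiple : ∀ {q c} d' → ¬ P ∣ q → ¬ P ∣ c → ¬ P ∣ d' →
                        PrimitivelyRepresents (q * P) c (d' * P) (P * P)
  represents-multiple {q} {c} d' P∤q P∤c P∤d' =
    embed (binaryFormRoot-exists q (q * c) d' P∤q (P∤* P∤q P∤c) P∤d')
    where
    expand : ∀ q c d' z w P →
      0ℤ * 0ℤ - q * P * (z * z) - c * (P * P) - q * P * c * (w * w) - d' * P ≡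
      (- (q * (z * z) + q * c * (w * w) + d')) * P + - c * (P * P)
    expand = solve-∀
    embed : BinaryFormRoot q (q * c) d' P → PrimitivelyRepresents (q * P) c (d' * P) (P * P)
    embed (root z w P∤z⊎P∤w P∣) =
      representation 0ℤ z P w
        (λ g _ g∣z g∣p g∣w →
           [ common-divisor-with-p≡1 g∣p g∣z , common-divisor-with-p≡1 g∣p g∣w ]′ P∤z⊎P∤w) $
        subst (P * P ∣_) (sym (expand q c d' z w P))
          (∣m∣n⇒∣m+n (*-monoˡ-∣ P (∣m⇒∣-m P∣)) (∣n⇒∣m*n (- c) ∣-refl))

  squareFree⇒P∤cofactor : ∀ {n m} → SquareFree n → n ≡ m * P → ¬ P ∣ m
  squareFree⇒P∤cofactor {n} {m} sf n≡mP P∣m =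
    ℕ.nonTrivial⇒≢1 {{prime⇒nonTrivial p-prime}} (sf p p²∣n)
    where
    p²∣n : p ℕ.* p ℕᵈ.∣ ∣ n ∣
    p²∣n = subst₂ ℕᵈ._∣_ (abs-* P P) (cong ∣_∣ (sym n≡mP)) (∣⇒∣ᵤ (*-monoˡ-∣ P P∣m))

  represents-mod-p² : ∀ {q c d} → ¬ P ∣ q → ¬ P ∣ c → SquareFree d →
                      PrimitivelyRepresents (q * P) c d (P * P)
  represents-mod-p² {q} {d = d} P∤q P∤c sf-d with P ∣? d
  ... | no P∤d = represents-unit q P∤c P∤d
  ... | yes (divides d' refl) = represents-multiple d' P∤q P∤c (squareFree⇒P∤cofactor sf-d refl)

  represents-when-p∣a : ∀ {a b d} → p ℕᵈ.∣ a → ¬ p ℕᵈ.∣ b → SquareFree (+ a) → SquareFree d →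
                        PrimitivelyRepresents (+ a) (+ b) d (+ (p ℕ.* p))
  represents-when-p∣a {b = b} {d} (ℕᵈ.divides q refl) p∤b sf-a sf-d =
    subst₂ (λ a m → PrimitivelyRepresents a (+ b) d m) (sym (pos-* q p)) (sym (pos-* p p))
      (represents-mod-p² (squareFree⇒P∤cofactor {m = + q} sf-a (pos-* q p)) (P∤+ p∤b) sf-d)

theorem3p2 : (a b : ℕ) → 0 ℕ.< a → 0 ℕ.< b → SquareFree (+ a) → SquareFree (+ b) → gcd a b ℕ.≤ 2 →
    (d : ℤ) → SquareFree d →
    (p : ℕ) → Prime p → p ≢ 2 → p ℕᵈ.∣ (a ℕ.* b) →
    ∃[ r₀ ] ∃[ r₁ ] ∃[ r₂ ] ∃[ r₃ ]
      ((gcd₄ r₀ r₁ r₂ r₃ ≡ 1) × (f (+ a) (+ b) r₀ r₁ r₂ r₃ ≡ d [mod + (p ℕ.* p) ]))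
theorem3p2 a b 0<a _ sf-a sf-b gcd≤2 d sf-d p p-prime p≢2 p∣ab =
  primitivelyRepresents⇒gcd₄≡1 (represents (euclidsLemma a b p-prime p∣ab))
  where
  open OddPrime p-prime p≢2
  p∣a⇒p∤b : p ℕᵈ.∣ a → ¬ p ℕᵈ.∣ b
  p∣a⇒p∤b = prime≢2∤-when-gcd≤2 p-prime p≢2 0<a gcd≤2
  represents : p ℕᵈ.∣ a ⊎ p ℕᵈ.∣ b → PrimitivelyRepresents (+ a) (+ b) d (+ (p ℕ.* p))
  represents (inj₁ p∣a) = represents-when-p∣a p∣a (p∣a⇒p∤b p∣a) sf-a sf-d
  represents (inj₂ p∣b) =
    primitivelyRepresents-swap (represents-when-p∣a p∣b (λ p∣a → p∣a⇒p∤b p∣a p∣b) sf-b sf-d)
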